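{- Let $\mathbb G$, $\mathbb H$ be graphs such that $\mathbb H$ has at least one vertex. Then there exists a surjective locally surjective homomorphism from $\mathbb G$ onto $\mathbb H$ if and only if there is a surjective $p$-morphism from $\operatorname{Pos}(\mathbb G)$ onto $\operatorname{Pos}(\mathbb H)$.
   Context: A graph $\mathbb G$ consists of a vertex set $V^{\mathbb G}$ and an edge set $E^{\mathbb G}$ of two-element subsets of $V^{\mathbb G}$; the edge $\{u,v\}$ is written $uv$. A map $g\colon V^{\mathbb G}\to V^{\mathbb H}$ is a locally surjective homomorphism if (HP) $uv\in E^{\mathbb G}$ implies $g(u)g(v)\in E^{\mathbb H}$, and (BP) for all $u\in V^{\mathbb G}$, $w\in V^{\mathbb H}$ with $g(u)w\in E^{\mathbb H}$ there is $v\in V^{\mathbb G}$ with $uv\in E^{\mathbb G}$ and $g(v)=w$. For posets $\mathbb P,\mathbb Q$ (carriers $X^{\mathbb P},X^{\mathbb Q}$), a $p$-morphism is a map $h\colon X^{\mathbb P}\to X^{\mathbb Q}$ such that (HP) $x\leq^{\mathbb P}y$ implies $h(x)\leq^{\mathbb Q}h(y)$, and (BP) whenever $h(x)\leq^{\mathbb Q}y$ there is $z$ with $x\leq^{\mathbb P}z$ and $h(z)=y$. Construction of $\operatorname{Pos}(\mathbb G)$: its carrier is $V\cup V_a\cup V_b\cup E_1\cup E_2\cup\{\top_1,\top_2,\infty_a,\infty_b\}$, where $V=V^{\mathbb G}$, $V_a=\{v_a:v\in V\}$ and $V_b=\{v_b:v\in V\}$ are disjoint copies of $V$, $E_1=\{e_1:e\in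 E^{\mathbb G}\}$ and $E_2=\{e_2:e\in E^{\mathbb G}\}$ are disjoint copies of $E^{\mathbb G}$, and $\top_1,\top_2,\infty_a,\infty_b$ are four new elements. The order is the reflexive–transitive closure of the following covering relation: $v\prec v_a$, $v\prec v_b$, $v_a\prec\infty_a$, $v_b\prec\infty_b$ for every $v\in V$; $e_1\prec\top_1$, $e_1\prec\top_2$, $e_2\prec\top_1$, $e_2\prec\top_2$ for every $e\in E^{\mathbb G}$; $v_a\prec\top_1,\ v_a\prec\top_2,\ v_b\prec\top_1,\ v_b\prec\top_2$ for every isolated vertex $v$; and for every edge $e=uv$, covers $u_a\prec e_i$, $v_b\prec e_i$, $u_b\prec e_j$, $v_a\prec e_j$ where $\{i,j\}=\{1,2\}$ (for each edge one of its two copies is chosen, arbitrarily, to lie above $u_a$ and $v_b$, and the other lies above $u_b$ and $v_a$). -}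

module Defs where

open import Data.Product using (Σ; ∃; _×_; _,_)
open import Data.Sum using (_⊎_)
open import Data.Empty using (⊥)
open import Relation.Nullary using (¬_)
open import Relation.Binary.PropositionalEquality using (_≡_)
open import Relation.Binary.Construct.Closure.ReflexiveTransitive using (Star)

-- Each edge e ∈ E represents the
-- two-element set {src e, tgt e}; distinct elements of E represent
-- distinct two-element sets.  The (arbitrary) ordering of the two
-- endpoints of an edge fixes the arbitrary choice made in Pos(G).
record Graph : Set₁ where
  field
    V    : Set
    E    : Set
    src  : E → V
    tgt  : E → V
    loopless : ∀ e → ¬ (src e ≡ tgt e)
    simple   : ∀ e e' →
               ((src e ≡ src e' × tgt e ≡ tgt e') ⊎ (src e ≡ tgt e' × tgt e ≡ src e'))
               → e ≡ e'

open Graph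

Adj : (G : Graph) → V G → V G → Set
Adj G u v = Σ (E G) λ e → (src G e ≡ u × tgt G e ≡ v) ⊎ (src G e ≡ v × tgt G e ≡ u)

Isolated : (G : Graph) → V G → Set
Isolated G v = ∀ w → ¬ Adj G v w

Surjective : {A B : Set} → (A → B) → Set
Surjective {A} {B} f = ∀ (b : B) → ∃ λ (a : A) → f a ≡ b

record LocSurjHom (G H : Graph) (g : V G → V H) : Set where
  field
    hom  : ∀ u v → Adj G u v → Adj H (g u) (g v)
    back : ∀ u w → Adj H (g u) w → ∃ λ v → Adj G u v × g v ≡ w

record Poset : Set₁ where
  field
    X   : Set
    _≤_ : X → X → Set

record PMorphism (P Q : Poset) (h : Poset.X P → Poset.X Q) : Set where
  field
    hom  : ∀ x y → Poset._≤_ P x y → Poset._≤_ Q (h x) (h y)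
    back : ∀ x y → Poset._≤_ Q (h x) y → ∃ λ z → Poset._≤_ P x z × h z ≡ y

data PosElt (G : Graph) : Set where
  vtx  : V G → PosElt G
  va   : V G → PosElt G
  vb   : V G → PosElt G
  e₁   : E G → PosElt G
  e₂   : E G → PosElt G
  ⊤₁   : PosElt G
  ⊤₂   : PosElt G
  ∞a   : PosElt G
  ∞b   : PosElt G

data Cover (G : Graph) : PosElt G → PosElt G → Set where
  v≺va  : ∀ v → Cover G (vtx v) (va v)
  v≺vb  : ∀ v → Cover G (vtx v) (vb v)
  va≺∞a : ∀ v → Cover G (va v) ∞a
  vb≺∞b : ∀ v → Cover G (vb v) ∞b
  e₁≺⊤₁ : ∀ e → Cover G (e₁ e) ⊤₁
  e₁≺⊤₂ : ∀ e → Cover G (e₁ e) ⊤₂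
  e₂≺⊤₁ : ∀ e → Cover G (e₂ e) ⊤₁
  e₂≺⊤₂ : ∀ e → Cover G (e₂ e) ⊤₂
  iso-a⊤₁ : ∀ v → Isolated G v → Cover G (va v) ⊤₁
  iso-a⊤₂ : ∀ v → Isolated G v → Cover G (va v) ⊤₂
  iso-b⊤₁ : ∀ v → Isolated G v → Cover G (vb v) ⊤₁
  iso-b⊤₂ : ∀ v → Isolated G v → Cover G (vb v) ⊤₂
  srca≺e₁ : ∀ e → Cover G (va (src G e)) (e₁ e)
  tgtb≺e₁ : ∀ e → Cover G (vb (tgt G e)) (e₁ e)
  srcb≺e₂ : ∀ e → Cover G (vb (src G e)) (e₂ e)
  tgta≺e₂ : ∀ e → Cover G (va (tgt G e)) (e₂ e)

Pos : Graph → Poset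
Pos G = record { X = PosElt G ; _≤_ = Star (Cover G) }

module Submission where

-- Forward: g lifts to Pos in the evident way, the copy of an edge e that lies above side s of
-- an endpoint going to the copy of the image edge that lies above side s of the image of that
-- endpoint; local surjectivity of g is exactly the back condition at the covers of sides.
-- Backward: a p-morphism maps maximal elements to maximal ones, so it permutes the four peaks.
-- Looking at what lies below which peaks, it maps non-vertices to non-vertices, vertices (the
-- elements below both ∞'s) to vertices, the sides of v to the sides of its image (swapping a and
-- b exactly when it swaps ∞a and ∞b) and edge copies to edge copies. The restriction g to
-- vertices is then a locally surjective homomorphism, because which sides lie below an edge copy
-- determines the edge.

open import Defs
open import Data.Product using (Σ; ∃; ∃₂; _×_; _,_; proj₁; proj₂)
open import Data.Sum using (_⊎_; inj₁; inj₂)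
open import Data.Empty using (⊥; ⊥-elim)
open import Relation.Nullary using (¬_; Dec; yes; no)
open import Relation.Binary.PropositionalEquality
  using (_≡_; _≢_; refl; sym; trans; cong; subst; subst₂; module ≡-Reasoning)
open import Relation.Binary.Construct.Closure.ReflexiveTransitive using (Star; ε; _◅_; _◅◅_; gmap)
open import Function.Bundles using (_⇔_; mk⇔)
open Graph

data Side : Set where
  a b : Side

opp : Side → Side
opp a = b
opp b = a

opp-no-fixpoint : ∀ {s} → s ≢ opp s
opp-no-fixpoint {a} ()
opp-no-fixpoint {b} ()

opp-involutive : ∀ s → opp (opp s) ≡ s
opp-involutive a = refl
opp-involutive b = refl

data Peak : Set where
  ∞ : Side → Peak
  ⊤₁ ⊤₂ : Peak

IsInf : Peak → Set
IsInf p = ∃ λ s → p ≡ ∞ s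

⊤₁-not-inf : ¬ IsInf ⊤₁
⊤₁-not-inf (_ , ())

⊤₂-not-inf : ¬ IsInf ⊤₂
⊤₂-not-inf (_ , ())

Maximal : (P : Poset) → Poset.X P → Set
Maximal P x = ∀ {y} → Poset._≤_ P x y → y ≡ x

p-morphism-maximal : ∀ {P Q h} → PMorphism P Q h → ∀ {x} → Maximal P x → Maximal Q (h x)
p-morphism-maximal {h = h} pm {x} max le with PMorphism.back pm x _ le
... | z , xz , refl = cong h (max xz)

side-id-or-opp : ∀ (f : Side → Side) → f a ≢ f b → (∀ s → f s ≡ s) ⊎ (∀ s → f s ≡ opp s)
side-id-or-opp f ne with f a in p | f b in q
... | a | a = ⊥-elim (ne refl)
... | a | b = inj₁ λ { a → p ; b → q }
... | b | a = inj₂ λ { a → p ; b → q }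
... | b | b = ⊥-elim (ne refl)

side-injective-involutive : ∀ (f : Side → Side) → f a ≢ f b → ∀ s → f (f s) ≡ s
side-injective-involutive f ne s with side-id-or-opp f ne
... | inj₁ e = trans (e (f s)) (e s)
... | inj₂ e = trans (e (f s)) (trans (cong opp (e s)) (opp-involutive s))

side-injective-opp : ∀ (f : Side → Side) → f a ≢ f b → ∀ s → f (opp s) ≡ opp (f s)
side-injective-opp f ne s with side-id-or-opp f ne
... | inj₁ e = trans (e (opp s)) (cong opp (sym (e s)))
... | inj₂ e = trans (e (opp s)) (cong opp (sym (e s)))

back-along-star : ∀ {A B : Set} {R : A → A → Set} {S : B → B → Set} (f : A → B) →
                  (∀ x {y} → S (f x) y → ∃ λ z → Star R x z × f z ≡ y) →
                  ∀ x {y} → Star S (f x) y → ∃ λ z → Star R x z × f z ≡ y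
back-along-star f back x ε = x , ε , refl
back-along-star f back x (c ◅ cs) with back x c
... | z , xz , refl with back-along-star f back z cs
...   | z' , zz' , eq = z' , xz ◅◅ zz' , eq

module PosOf (K : Graph) where

  _≤_ : PosElt K → PosElt K → Set
  _≤_ = Star (Cover K)

  side : Side → V K → PosElt K
  side a = va
  side b = vb

  copy : Side → E K → PosElt K
  copy a = e₁
  copy b = e₂

  peak : Peak → PosElt K
  peak (∞ a) = ∞a
  peak (∞ b) = ∞b
  peak ⊤₁ = ⊤₁
  peak ⊤₂ = ⊤₂

  -- copy t f covers side s of the vertex endpoint s t f: the source of f when s = t, its target
  -- otherwise.
  endpoint : Side → Side → E K → V K
  endpoint a a = src K
  endpoint b b = src K
  endpoint a b = tgt K
  endpoint b a = tgt K

  IsVertex IsCopy IsPeak : PosElt K → Set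
  IsVertex x = ∃ λ w → x ≡ vtx w
  IsCopy x = ∃₂ λ t f → x ≡ copy t f
  IsPeak x = ∃ λ p → x ≡ peak p

  vtx-injective : ∀ {w w'} → _≡_ {A = PosElt K} (vtx w) (vtx w') → w ≡ w'
  vtx-injective refl = refl

  side-injective : ∀ {s s' w w'} → side s w ≡ side s' w' → s ≡ s' × w ≡ w'
  side-injective {a} {a} refl = refl , refl
  side-injective {b} {b} refl = refl , refl

  vertex? : ∀ x → Dec (IsVertex x)
  vertex? (vtx w) = yes (w , refl)
  vertex? (va _) = no λ { (_ , ()) }
  vertex? (vb _) = no λ { (_ , ()) }
  vertex? (e₁ _) = no λ { (_ , ()) }
  vertex? (e₂ _) = no λ { (_ , ()) }
  vertex? ⊤₁ = no λ { (_ , ()) }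
  vertex? ⊤₂ = no λ { (_ , ()) }
  vertex? ∞a = no λ { (_ , ()) }
  vertex? ∞b = no λ { (_ , ()) }

  side≢vtx : ∀ {s w w'} → side s w ≢ vtx w'
  side≢vtx {a} ()
  side≢vtx {b} ()

  side≢copy : ∀ {s t w f} → side s w ≢ copy t f
  side≢copy {a} {a} ()
  side≢copy {a} {b} ()
  side≢copy {b} {a} ()
  side≢copy {b} {b} ()

  side≢peak : ∀ {s w} p → side s w ≢ peak p
  side≢peak {a} (∞ a) ()
  side≢peak {a} (∞ b) ()
  side≢peak {a} ⊤₁ ()
  side≢peak {a} ⊤₂ ()
  side≢peak {b} (∞ a) ()
  side≢peak {b} (∞ b) ()
  side≢peak {b} ⊤₁ ()
  side≢peak {b} ⊤₂ ()

  copy≢vtx : ∀ {t f w} → copy t f ≢ vtx w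
  copy≢vtx {a} ()
  copy≢vtx {b} ()

  copy≢peak : ∀ {t f} p → copy t f ≢ peak p
  copy≢peak {a} (∞ a) ()
  copy≢peak {a} (∞ b) ()
  copy≢peak {a} ⊤₁ ()
  copy≢peak {a} ⊤₂ ()
  copy≢peak {b} (∞ a) ()
  copy≢peak {b} (∞ b) ()
  copy≢peak {b} ⊤₁ ()
  copy≢peak {b} ⊤₂ ()

  side-nonvertex : ∀ s w → ¬ IsVertex (side s w)
  side-nonvertex _ _ (_ , eq) = side≢vtx eq

  copy-nonvertex : ∀ t f → ¬ IsVertex (copy t f)
  copy-nonvertex _ _ (_ , eq) = copy≢vtx eq

  endpoint-same : ∀ s f → endpoint s s f ≡ src K f
  endpoint-same a f = refl
  endpoint-same b f = refl

  endpoint-opp : ∀ s f → endpoint (opp s) s f ≡ tgt K f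
  endpoint-opp a f = refl
  endpoint-opp b f = refl

  endpoints-adjacent : ∀ s t f → Adj K (endpoint s t f) (endpoint (opp s) t f)
  endpoints-adjacent a a f = f , inj₁ (refl , refl)
  endpoints-adjacent b b f = f , inj₁ (refl , refl)
  endpoints-adjacent a b f = f , inj₂ (refl , refl)
  endpoints-adjacent b a f = f , inj₂ (refl , refl)

  adj-sym : ∀ {u v} → Adj K u v → Adj K v u
  adj-sym (f , inj₁ (p , q)) = f , inj₂ (p , q)
  adj-sym (f , inj₂ (p , q)) = f , inj₁ (p , q)

  same-ends : ∀ {e f} → src K e ≡ src K f → tgt K e ≡ tgt K f → e ≡ f
  same-ends p q = simple K _ _ (inj₁ (p , q))

  crossed-ends : ∀ {e f} → src K e ≡ tgt K f → tgt K e ≡ src K f → ⊥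
  crossed-ends {e} p q with simple K _ _ (inj₂ (p , q))
  ... | refl = loopless K e p

  copy-determined : ∀ s t {e f} → src K e ≡ endpoint s t f → tgt K e ≡ endpoint (opp s) t f →
                    copy s e ≡ copy t f
  copy-determined a a p q = cong e₁ (same-ends p q)
  copy-determined b b p q = cong e₂ (same-ends p q)
  copy-determined a b p q = ⊥-elim (crossed-ends p q)
  copy-determined b a p q = ⊥-elim (crossed-ends p q)

  -- The copy of the edge of α lying above side s of its first vertex.
  over : ∀ {x y} → Side → Adj K x y → PosElt K
  over s (f , inj₁ _) = copy s f
  over s (f , inj₂ _) = copy (opp s) f

  over-is-copy : ∀ {x y} s (α : Adj K x y) → IsCopy (over s α)
  over-is-copy s (f , inj₁ _) = s , f , refl
  over-is-copy s (f , inj₂ _) = opp s , f , refl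

  over-determined : ∀ s {t x y f} (α : Adj K x y) → x ≡ endpoint s t f → y ≡ endpoint (opp s) t f →
                    over s α ≡ copy t f
  over-determined s (e , inj₁ (refl , refl)) p q = copy-determined s _ p q
  over-determined a (e , inj₂ (refl , refl)) p q = copy-determined b _ q p
  over-determined b (e , inj₂ (refl , refl)) p q = copy-determined a _ q p

  vtx≺side : ∀ s w → Cover K (vtx w) (side s w)
  vtx≺side a = v≺va
  vtx≺side b = v≺vb

  side≺∞ : ∀ s w → Cover K (side s w) (peak (∞ s))
  side≺∞ a = va≺∞a
  side≺∞ b = vb≺∞b

  side≺copy : ∀ s t f → Cover K (side s (endpoint s t f)) (copy t f)
  side≺copy a a = srca≺e₁
  side≺copy b a = tgtb≺e₁
  side≺copy a b = tgta≺e₂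
  side≺copy b b = srcb≺e₂

  side≺over : ∀ {x y} s (α : Adj K x y) → Cover K (side s x) (over s α)
  side≺over a (f , inj₁ (refl , _)) = srca≺e₁ f
  side≺over b (f , inj₁ (refl , _)) = srcb≺e₂ f
  side≺over a (f , inj₂ (_ , refl)) = tgta≺e₂ f
  side≺over b (f , inj₂ (_ , refl)) = tgtb≺e₁ f

  opp-side≺over : ∀ {x y} s (α : Adj K x y) → Cover K (side (opp s) y) (over s α)
  opp-side≺over a (f , inj₁ (_ , refl)) = tgtb≺e₁ f
  opp-side≺over b (f , inj₁ (_ , refl)) = tgta≺e₂ f
  opp-side≺over a (f , inj₂ (refl , _)) = srcb≺e₂ f
  opp-side≺over b (f , inj₂ (refl , _)) = srca≺e₁ f

  copy≺top : ∀ t f {m} → ¬ IsInf m → Cover K (copy t f) (peak m)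
  copy≺top _ _ {∞ s} fin = ⊥-elim (fin (s , refl))
  copy≺top a f {⊤₁} _ = e₁≺⊤₁ f
  copy≺top a f {⊤₂} _ = e₁≺⊤₂ f
  copy≺top b f {⊤₁} _ = e₂≺⊤₁ f
  copy≺top b f {⊤₂} _ = e₂≺⊤₂ f

  over≺top : ∀ {x y} s (α : Adj K x y) {m} → ¬ IsInf m → Cover K (over s α) (peak m)
  over≺top s (f , inj₁ _) = copy≺top s f
  over≺top s (f , inj₂ _) = copy≺top (opp s) f

  isolated≺top : ∀ s {w} → Isolated K w → ∀ {m} → ¬ IsInf m → Cover K (side s w) (peak m)
  isolated≺top _ _ {∞ s} fin = ⊥-elim (fin (s , refl))
  isolated≺top a i {⊤₁} _ = iso-a⊤₁ _ i
  isolated≺top a i {⊤₂} _ = iso-a⊤₂ _ i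
  isolated≺top b i {⊤₁} _ = iso-b⊤₁ _ i
  isolated≺top b i {⊤₂} _ = iso-b⊤₂ _ i

  vertex-cover : ∀ {w y} → Cover K (vtx w) y → ∃ λ s → y ≡ side s w
  vertex-cover (v≺va _) = a , refl
  vertex-cover (v≺vb _) = b , refl

  side-cover : ∀ s {w y} → Cover K (side s w) y →
               y ≡ peak (∞ s)
               ⊎ (Isolated K w × ∃ λ m → ¬ IsInf m × y ≡ peak m)
               ⊎ (∃₂ λ t f → w ≡ endpoint s t f × y ≡ copy t f)
  side-cover a (va≺∞a _) = inj₁ refl
  side-cover a (iso-a⊤₁ _ i) = inj₂ (inj₁ (i , ⊤₁ , ⊤₁-not-inf , refl))
  side-cover a (iso-a⊤₂ _ i) = inj₂ (inj₁ (i , ⊤₂ , ⊤₂-not-inf , refl))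
  side-cover a (srca≺e₁ f) = inj₂ (inj₂ (a , f , refl , refl))
  side-cover a (tgta≺e₂ f) = inj₂ (inj₂ (b , f , refl , refl))
  side-cover b (vb≺∞b _) = inj₁ refl
  side-cover b (iso-b⊤₁ _ i) = inj₂ (inj₁ (i , ⊤₁ , ⊤₁-not-inf , refl))
  side-cover b (iso-b⊤₂ _ i) = inj₂ (inj₁ (i , ⊤₂ , ⊤₂-not-inf , refl))
  side-cover b (tgtb≺e₁ f) = inj₂ (inj₂ (a , f , refl , refl))
  side-cover b (srcb≺e₂ f) = inj₂ (inj₂ (b , f , refl , refl))

  copy-cover : ∀ t {f y} → Cover K (copy t f) y → ∃ λ m → ¬ IsInf m × y ≡ peak m
  copy-cover a (e₁≺⊤₁ _) = ⊤₁ , ⊤₁-not-inf , refl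
  copy-cover a (e₁≺⊤₂ _) = ⊤₂ , ⊤₂-not-inf , refl
  copy-cover b (e₂≺⊤₁ _) = ⊤₁ , ⊤₁-not-inf , refl
  copy-cover b (e₂≺⊤₂ _) = ⊤₂ , ⊤₂-not-inf , refl

  over-cover : ∀ {x y z} s (α : Adj K x y) → Cover K (over s α) z → ∃ λ m → ¬ IsInf m × z ≡ peak m
  over-cover s (f , inj₁ _) = copy-cover s
  over-cover s (f , inj₂ _) = copy-cover (opp s)

  peakAbove : PosElt K → Peak
  peakAbove (vtx _) = ∞ a
  peakAbove (va _) = ∞ a
  peakAbove (vb _) = ∞ b
  peakAbove (e₁ _) = ⊤₁
  peakAbove (e₂ _) = ⊤₁
  peakAbove ⊤₁ = ⊤₁
  peakAbove ⊤₂ = ⊤₂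
  peakAbove ∞a = ∞ a
  peakAbove ∞b = ∞ b

  peakAbove-peak : ∀ p → peakAbove (peak p) ≡ p
  peakAbove-peak (∞ a) = refl
  peakAbove-peak (∞ b) = refl
  peakAbove-peak ⊤₁ = refl
  peakAbove-peak ⊤₂ = refl

  peak-injective : ∀ {p q} → peak p ≡ peak q → p ≡ q
  peak-injective {p} {q} eq =
    trans (sym (peakAbove-peak p)) (trans (cong peakAbove eq) (peakAbove-peak q))

  ≤-peakAbove : ∀ x → x ≤ peak (peakAbove x)
  ≤-peakAbove (vtx v) = v≺va v ◅ va≺∞a v ◅ ε
  ≤-peakAbove (va v) = va≺∞a v ◅ ε
  ≤-peakAbove (vb v) = vb≺∞b v ◅ ε
  ≤-peakAbove (e₁ f) = e₁≺⊤₁ f ◅ ε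
  ≤-peakAbove (e₂ f) = e₂≺⊤₁ f ◅ ε
  ≤-peakAbove ⊤₁ = ε
  ≤-peakAbove ⊤₂ = ε
  ≤-peakAbove ∞a = ε
  ≤-peakAbove ∞b = ε

  peak-no-cover : ∀ p {y} → ¬ Cover K (peak p) y
  peak-no-cover (∞ a) ()
  peak-no-cover (∞ b) ()
  peak-no-cover ⊤₁ ()
  peak-no-cover ⊤₂ ()

  peak-maximal : ∀ p → Maximal (Pos K) (peak p)
  peak-maximal p ε = refl
  peak-maximal p (c ◅ _) = ⊥-elim (peak-no-cover p c)

  peak-below-peak : ∀ {p q} → peak p ≤ peak q → q ≡ p
  peak-below-peak {p} le = peak-injective (peak-maximal p le)

  maximal⇒peak : ∀ x → Maximal (Pos K) x → IsPeak x
  maximal⇒peak (vtx w) max with max (v≺va w ◅ ε)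
  ... | ()
  maximal⇒peak (va w) max with max (va≺∞a w ◅ ε)
  ... | ()
  maximal⇒peak (vb w) max with max (vb≺∞b w ◅ ε)
  ... | ()
  maximal⇒peak (e₁ f) max with max (e₁≺⊤₁ f ◅ ε)
  ... | ()
  maximal⇒peak (e₂ f) max with max (e₂≺⊤₁ f ◅ ε)
  ... | ()
  maximal⇒peak ⊤₁ _ = ⊤₁ , refl
  maximal⇒peak ⊤₂ _ = ⊤₂ , refl
  maximal⇒peak ∞a _ = ∞ a , refl
  maximal⇒peak ∞b _ = ∞ b , refl

  IsolatedOrAdjacent : V K → Set
  IsolatedOrAdjacent v = Isolated K v ⊎ ∃ (Adj K v)

  -- Constructively only ¬¬ holds; it is applied to negative goals only.
  isolated-or-adjacent : ∀ v → ¬ ¬ IsolatedOrAdjacent v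
  isolated-or-adjacent v k = k (inj₁ (λ w α → k (inj₂ (w , α))))

  side-below-top : ∀ s {v} → IsolatedOrAdjacent v → ∀ {m} → ¬ IsInf m → side s v ≤ peak m
  side-below-top s (inj₁ i) fin = isolated≺top s i fin ◅ ε
  side-below-top s (inj₂ (_ , α)) fin = side≺over s α ◅ over≺top s α fin ◅ ε

  copy-below-top : ∀ {t f m} → ¬ IsInf m → copy t f ≤ peak m
  copy-below-top fin = copy≺top _ _ fin ◅ ε

  BelowSide : Side → V K → PosElt K → Set
  BelowSide s w x = x ≡ side s w ⊎ x ≡ vtx w

  BelowCopy : Side → E K → PosElt K → Set
  BelowCopy t f x = x ≡ copy t f ⊎ BelowSide t (src K f) x ⊎ BelowSide (opp t) (tgt K f) x

  BelowTop : PosElt K → Set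
  BelowTop x = (∃₂ λ t f → BelowCopy t f x) ⊎ (∃₂ λ s w → BelowSide s w x)

  -- An upper bound for the order of Pos K, given by down-sets. It is exact except that it puts
  -- every side below the tops, which in Pos K requires the vertex to be isolated or adjacent.
  _⊑_ : PosElt K → PosElt K → Set
  x ⊑ vtx w = x ≡ vtx w
  x ⊑ va w = BelowSide a w x
  x ⊑ vb w = BelowSide b w x
  x ⊑ e₁ f = BelowCopy a f x
  x ⊑ e₂ f = BelowCopy b f x
  x ⊑ ∞a = x ≡ ∞a ⊎ ∃ λ w → BelowSide a w x
  x ⊑ ∞b = x ≡ ∞b ⊎ ∃ λ w → BelowSide b w x
  x ⊑ ⊤₁ = x ≡ ⊤₁ ⊎ BelowTop x
  x ⊑ ⊤₂ = x ≡ ⊤₂ ⊎ BelowTop x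

  ⊑-refl : ∀ x → x ⊑ x
  ⊑-refl (vtx _) = refl
  ⊑-refl (va _) = inj₁ refl
  ⊑-refl (vb _) = inj₁ refl
  ⊑-refl (e₁ _) = inj₁ refl
  ⊑-refl (e₂ _) = inj₁ refl
  ⊑-refl ⊤₁ = inj₁ refl
  ⊑-refl ⊤₂ = inj₁ refl
  ⊑-refl ∞a = inj₁ refl
  ⊑-refl ∞b = inj₁ refl

  ⊑-≺-trans : ∀ {x y z} → x ⊑ y → Cover K y z → x ⊑ z
  ⊑-≺-trans d (v≺va _) = inj₂ d
  ⊑-≺-trans d (v≺vb _) = inj₂ d
  ⊑-≺-trans d (va≺∞a w) = inj₂ (w , d)
  ⊑-≺-trans d (vb≺∞b w) = inj₂ (w , d)
  ⊑-≺-trans d (e₁≺⊤₁ f) = inj₂ (inj₁ (a , f , d))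
  ⊑-≺-trans d (e₁≺⊤₂ f) = inj₂ (inj₁ (a , f , d))
  ⊑-≺-trans d (e₂≺⊤₁ f) = inj₂ (inj₁ (b , f , d))
  ⊑-≺-trans d (e₂≺⊤₂ f) = inj₂ (inj₁ (b , f , d))
  ⊑-≺-trans d (iso-a⊤₁ w _) = inj₂ (inj₂ (a , w , d))
  ⊑-≺-trans d (iso-a⊤₂ w _) = inj₂ (inj₂ (a , w , d))
  ⊑-≺-trans d (iso-b⊤₁ w _) = inj₂ (inj₂ (b , w , d))
  ⊑-≺-trans d (iso-b⊤₂ w _) = inj₂ (inj₂ (b , w , d))
  ⊑-≺-trans d (srca≺e₁ _) = inj₂ (inj₁ d)
  ⊑-≺-trans d (tgtb≺e₁ _) = inj₂ (inj₂ d)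
  ⊑-≺-trans d (srcb≺e₂ _) = inj₂ (inj₁ d)
  ⊑-≺-trans d (tgta≺e₂ _) = inj₂ (inj₂ d)

  ⊑-≤-trans : ∀ {x y z} → x ⊑ y → y ≤ z → x ⊑ z
  ⊑-≤-trans d ε = d
  ⊑-≤-trans d (c ◅ cs) = ⊑-≤-trans (⊑-≺-trans d c) cs

  ≤⇒⊑ : ∀ {x y} → x ≤ y → x ⊑ y
  ≤⇒⊑ = ⊑-≤-trans (⊑-refl _)

  below-side : ∀ {x} s {w} → x ≤ side s w → BelowSide s w x
  below-side a = ≤⇒⊑
  below-side b = ≤⇒⊑

  below-copy : ∀ {x} t {f} → x ≤ copy t f → BelowCopy t f x
  below-copy a = ≤⇒⊑
  below-copy b = ≤⇒⊑

  below-∞ : ∀ {x} s → x ≤ peak (∞ s) → x ≡ peak (∞ s) ⊎ ∃ λ w → BelowSide s w x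
  below-∞ a = ≤⇒⊑
  below-∞ b = ≤⇒⊑

  side-in-BelowSide : ∀ {s s' w w'} → BelowSide s' w' (side s w) → s ≡ s' × w ≡ w'
  side-in-BelowSide (inj₁ eq) = side-injective eq
  side-in-BelowSide (inj₂ eq) = ⊥-elim (side≢vtx eq)

  side-below-copy : ∀ {s t w f} → side s w ≤ copy t f → w ≡ endpoint s t f
  side-below-copy {t = t} le with below-copy t le
  ... | inj₁ eq = ⊥-elim (side≢copy eq)
  ... | inj₂ (inj₁ d) with side-in-BelowSide d
  ...   | refl , refl = sym (endpoint-same t _)
  side-below-copy {t = t} le | inj₂ (inj₂ d) with side-in-BelowSide d
  ...   | refl , refl = sym (endpoint-opp t _)

  adjacent-below-copy : ∀ {s t x y f} → side s x ≤ copy t f → side (opp s) y ≤ copy t f → Adj K x y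
  adjacent-below-copy {s} {t} {f = f} le le' =
    subst₂ (Adj K) (sym (side-below-copy le)) (sym (side-below-copy le')) (endpoints-adjacent s t f)

  sides-below-same-copy : ∀ {s x y c} → IsCopy c → side s x ≤ c → side s y ≤ c → x ≡ y
  sides-below-same-copy (_ , _ , refl) le le' =
    trans (side-below-copy le) (sym (side-below-copy le'))

  vertex-below-side : ∀ {s w w'} → vtx w ≤ side s w' → w ≡ w'
  vertex-below-side {s} le with below-side s le
  ... | inj₁ eq = ⊥-elim (side≢vtx (sym eq))
  ... | inj₂ refl = refl

  ∞≰opp-∞ : ∀ {s} → ¬ peak (∞ s) ≤ peak (∞ (opp s))
  ∞≰opp-∞ le = opp-no-fixpoint (sym (∞-injective (peak-below-peak le)))
    where
    ∞-injective : ∀ {s t} → ∞ s ≡ ∞ t → s ≡ t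
    ∞-injective refl = refl

  side≰opp-∞ : ∀ {s w} → ¬ side s w ≤ peak (∞ (opp s))
  side≰opp-∞ {s} le with below-∞ (opp s) le
  ... | inj₁ eq = side≢peak _ eq
  ... | inj₂ (_ , inj₁ eq) = opp-no-fixpoint (proj₁ (side-injective eq))
  ... | inj₂ (_ , inj₂ eq) = side≢vtx eq

  copy≰∞ : ∀ {s t f} → ¬ copy t f ≤ peak (∞ s)
  copy≰∞ {s} le with below-∞ s le
  ... | inj₁ eq = copy≢peak _ eq
  ... | inj₂ (_ , inj₁ eq) = side≢copy (sym eq)
  ... | inj₂ (_ , inj₂ eq) = copy≢vtx eq

  copy-peaks-are-tops : ∀ {t f m} → copy t f ≤ peak m → ¬ IsInf m
  copy-peaks-are-tops le (_ , refl) = copy≰∞ le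

  below-both-∞⇒vertex : ∀ {q} t → q ≤ peak (∞ t) → q ≤ peak (∞ (opp t)) → IsVertex q
  below-both-∞⇒vertex t le le' with below-∞ t le
  ... | inj₁ refl = ⊥-elim (∞≰opp-∞ le')
  ... | inj₂ (_ , inj₁ refl) = ⊥-elim (side≰opp-∞ le')
  ... | inj₂ (w , inj₂ refl) = w , refl

  side-between : ∀ {q w} t → vtx w ≤ q → q ≤ peak (∞ t) → ¬ IsVertex q → q ≢ peak (∞ t) →
                 q ≡ side t w
  side-between t vq le nv ne with below-∞ t le
  ... | inj₁ eq = ⊥-elim (ne eq)
  ... | inj₂ (_ , inj₁ refl) = cong (side t) (sym (vertex-below-side vq))
  ... | inj₂ (w , inj₂ refl) = ⊥-elim (nv (w , refl))

  below-two-peaks⇒copy : ∀ {q p p'} → q ≤ peak p → q ≤ peak p' → p ≢ p' →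
                        (∀ s → ¬ q ≤ peak (∞ s)) → ¬ IsVertex q → IsCopy q
  below-two-peaks⇒copy {vtx w} _ _ _ _ nv = ⊥-elim (nv (w , refl))
  below-two-peaks⇒copy {va w} _ _ _ no∞ _ = ⊥-elim (no∞ a (va≺∞a w ◅ ε))
  below-two-peaks⇒copy {vb w} _ _ _ no∞ _ = ⊥-elim (no∞ b (vb≺∞b w ◅ ε))
  below-two-peaks⇒copy {e₁ f} _ _ _ _ _ = a , f , refl
  below-two-peaks⇒copy {e₂ f} _ _ _ _ _ = b , f , refl
  below-two-peaks⇒copy {⊤₁} le le' ne _ _ =
    ⊥-elim (ne (trans (peak-below-peak {⊤₁} le) (sym (peak-below-peak {⊤₁} le'))))
  below-two-peaks⇒copy {⊤₂} le le' ne _ _ =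
    ⊥-elim (ne (trans (peak-below-peak {⊤₂} le) (sym (peak-below-peak {⊤₂} le'))))
  below-two-peaks⇒copy {∞a} _ _ _ no∞ _ = ⊥-elim (no∞ a ε)
  below-two-peaks⇒copy {∞b} _ _ _ no∞ _ = ⊥-elim (no∞ b ε)

  above-nonvertex : ∀ {x} z → ¬ IsVertex x → x ≤ z → z ≡ x ⊎ IsCopy z ⊎ IsPeak z
  above-nonvertex (vtx w) nv le = ⊥-elim (nv (w , ≤⇒⊑ le))
  above-nonvertex (va w) nv le with ≤⇒⊑ le
  ... | inj₁ refl = inj₁ refl
  ... | inj₂ eq = ⊥-elim (nv (w , eq))
  above-nonvertex (vb w) nv le with ≤⇒⊑ le
  ... | inj₁ refl = inj₁ refl
  ... | inj₂ eq = ⊥-elim (nv (w , eq))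
  above-nonvertex (e₁ f) _ _ = inj₂ (inj₁ (a , f , refl))
  above-nonvertex (e₂ f) _ _ = inj₂ (inj₁ (b , f , refl))
  above-nonvertex ⊤₁ _ _ = inj₂ (inj₂ (⊤₁ , refl))
  above-nonvertex ⊤₂ _ _ = inj₂ (inj₂ (⊤₂ , refl))
  above-nonvertex ∞a _ _ = inj₂ (inj₂ (∞ a , refl))
  above-nonvertex ∞b _ _ = inj₂ (inj₂ (∞ b , refl))

module Lift (G H : Graph) (g : V G → V H) (g-surjective : Surjective g)
            (g-lsh : LocSurjHom G H g) where
  open LocSurjHom g-lsh
  module Ĝ = PosOf G
  module Ĥ = PosOf H

  image : ∀ e → Adj H (g (src G e)) (g (tgt G e))
  image e = hom (src G e) (tgt G e) (e , inj₁ (refl , refl))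

  lift : PosElt G → PosElt H
  lift (vtx v) = vtx (g v)
  lift (va v) = va (g v)
  lift (vb v) = vb (g v)
  lift (e₁ e) = Ĥ.over a (image e)
  lift (e₂ e) = Ĥ.over b (image e)
  lift ⊤₁ = ⊤₁
  lift ⊤₂ = ⊤₂
  lift ∞a = ∞a
  lift ∞b = ∞b

  lift-side : ∀ s v → lift (Ĝ.side s v) ≡ Ĥ.side s (g v)
  lift-side a v = refl
  lift-side b v = refl

  lift-copy : ∀ t e → lift (Ĝ.copy t e) ≡ Ĥ.over t (image e)
  lift-copy a e = refl
  lift-copy b e = refl

  lift-peak : ∀ m → lift (Ĝ.peak m) ≡ Ĥ.peak m
  lift-peak (∞ a) = refl
  lift-peak (∞ b) = refl
  lift-peak ⊤₁ = refl
  lift-peak ⊤₂ = refl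

  isolated-preserved : ∀ {v} → Isolated G v → Isolated H (g v)
  isolated-preserved {v} i w α with back v w α
  ... | u , β , _ = i u β

  isolated-reflected : ∀ {v} → Isolated H (g v) → Isolated G v
  isolated-reflected {v} i u β = i (g u) (hom v u β)

  lift-over : ∀ s {t u v f} (β : Adj G u v) →
              g u ≡ Ĥ.endpoint s t f → g v ≡ Ĥ.endpoint (opp s) t f →
              lift (Ĝ.over s β) ≡ Ĥ.copy t f
  lift-over s (e , inj₁ (refl , refl)) p q =
    trans (lift-copy s e) (Ĥ.over-determined s (image e) p q)
  lift-over a (e , inj₂ (refl , refl)) p q = Ĥ.over-determined b (image e) q p
  lift-over b (e , inj₂ (refl , refl)) p q = Ĥ.over-determined a (image e) q p

  lift-copy-above : ∀ s {t f u} → g u ≡ Ĥ.endpoint s t f →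
                    ∃ λ z → Cover G (Ĝ.side s u) z × lift z ≡ Ĥ.copy t f
  lift-copy-above s {t} {f} {u} p
    with back u _ (subst (λ x → Adj H x _) (sym p) (Ĥ.endpoints-adjacent s t f))
  ... | v , β , q = Ĝ.over s β , Ĝ.side≺over s β , lift-over s β p q

  lift-cover : ∀ {x y} → Cover G x y → Cover H (lift x) (lift y)
  lift-cover (v≺va v) = v≺va (g v)
  lift-cover (v≺vb v) = v≺vb (g v)
  lift-cover (va≺∞a v) = va≺∞a (g v)
  lift-cover (vb≺∞b v) = vb≺∞b (g v)
  lift-cover (e₁≺⊤₁ e) = Ĥ.over≺top a (image e) ⊤₁-not-inf
  lift-cover (e₁≺⊤₂ e) = Ĥ.over≺top a (image e) ⊤₂-not-inf
  lift-cover (e₂≺⊤₁ e) = Ĥ.over≺top b (image e) ⊤₁-not-inf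
  lift-cover (e₂≺⊤₂ e) = Ĥ.over≺top b (image e) ⊤₂-not-inf
  lift-cover (iso-a⊤₁ v i) = iso-a⊤₁ (g v) (isolated-preserved i)
  lift-cover (iso-a⊤₂ v i) = iso-a⊤₂ (g v) (isolated-preserved i)
  lift-cover (iso-b⊤₁ v i) = iso-b⊤₁ (g v) (isolated-preserved i)
  lift-cover (iso-b⊤₂ v i) = iso-b⊤₂ (g v) (isolated-preserved i)
  lift-cover (srca≺e₁ e) = Ĥ.side≺over a (image e)
  lift-cover (tgtb≺e₁ e) = Ĥ.opp-side≺over a (image e)
  lift-cover (srcb≺e₂ e) = Ĥ.side≺over b (image e)
  lift-cover (tgta≺e₂ e) = Ĥ.opp-side≺over b (image e)

  lift-side-back : ∀ s v {y} → Cover H (Ĥ.side s (g v)) y →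
                   ∃ λ z → Cover G (Ĝ.side s v) z × lift z ≡ y
  lift-side-back s v c with Ĥ.side-cover s c
  ... | inj₁ refl = Ĝ.peak (∞ s) , Ĝ.side≺∞ s v , lift-peak (∞ s)
  ... | inj₂ (inj₁ (i , m , fin , refl)) =
    Ĝ.peak m , Ĝ.isolated≺top s (isolated-reflected i) fin , lift-peak m
  ... | inj₂ (inj₂ (t , f , p , refl)) = lift-copy-above s p

  lift-copy-back : ∀ t e {y} → Cover H (Ĥ.over t (image e)) y →
                   ∃ λ z → Cover G (Ĝ.copy t e) z × lift z ≡ y
  lift-copy-back t e c with Ĥ.over-cover t (image e) c
  ... | m , fin , refl = Ĝ.peak m , Ĝ.copy≺top t e fin , lift-peak m

  lift-back-cover : ∀ x {y} → Cover H (lift x) y → ∃ λ z → x Ĝ.≤ z × lift z ≡ y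
  lift-back-cover (vtx v) c with Ĥ.vertex-cover c
  ... | s , refl = Ĝ.side s v , Ĝ.vtx≺side s v ◅ ε , lift-side s v
  lift-back-cover (va v) c with lift-side-back a v c
  ... | z , c' , eq = z , c' ◅ ε , eq
  lift-back-cover (vb v) c with lift-side-back b v c
  ... | z , c' , eq = z , c' ◅ ε , eq
  lift-back-cover (e₁ e) c with lift-copy-back a e c
  ... | z , c' , eq = z , c' ◅ ε , eq
  lift-back-cover (e₂ e) c with lift-copy-back b e c
  ... | z , c' , eq = z , c' ◅ ε , eq
  lift-back-cover ⊤₁ ()
  lift-back-cover ⊤₂ ()
  lift-back-cover ∞a ()
  lift-back-cover ∞b ()

  lift-surjective : Surjective lift
  lift-surjective (vtx w) with g-surjective w
  ... | v , refl = vtx v , refl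
  lift-surjective (va w) with g-surjective w
  ... | v , refl = va v , refl
  lift-surjective (vb w) with g-surjective w
  ... | v , refl = vb v , refl
  lift-surjective (e₁ f) with g-surjective (src H f)
  ... | u , p with lift-copy-above a {t = a} p
  ...   | z , _ , eq = z , eq
  lift-surjective (e₂ f) with g-surjective (tgt H f)
  ... | u , p with lift-copy-above a {t = b} p
  ...   | z , _ , eq = z , eq
  lift-surjective ⊤₁ = ⊤₁ , refl
  lift-surjective ⊤₂ = ⊤₂ , refl
  lift-surjective ∞a = ∞a , refl
  lift-surjective ∞b = ∞b , refl

  lift-p-morphism : PMorphism (Pos G) (Pos H) lift
  lift-p-morphism = record
    { hom = λ _ _ → gmap lift lift-cover
    ; back = λ x _ → back-along-star lift lift-back-cover x
    }

module Reflect (G H : Graph) (w₀ : V H) (h : PosElt G → PosElt H) (h-surjective : Surjective h)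
               (h-pm : PMorphism (Pos G) (Pos H) h) where
  module Ĝ = PosOf G
  module Ĥ = PosOf H

  h-mono : ∀ {x y} → x Ĝ.≤ y → h x Ĥ.≤ h y
  h-mono = PMorphism.hom h-pm _ _

  h-back : ∀ {x y} → h x Ĥ.≤ y → ∃ λ z → x Ĝ.≤ z × h z ≡ y
  h-back = PMorphism.back h-pm _ _

  peak-image : ∀ m → Ĥ.IsPeak (h (Ĝ.peak m))
  peak-image m = Ĥ.maximal⇒peak _ (p-morphism-maximal h-pm (Ĝ.peak-maximal m))

  σ : Peak → Peak
  σ m = proj₁ (peak-image m)

  h-peak : ∀ m → h (Ĝ.peak m) ≡ Ĥ.peak (σ m)
  h-peak m = proj₂ (peak-image m)

  h-below-peak : ∀ {x m p} → σ m ≡ p → x Ĝ.≤ Ĝ.peak m → h x Ĥ.≤ Ĥ.peak p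
  h-below-peak {x} {m} refl le = subst (h x Ĥ.≤_) (h-peak m) (h-mono le)

  back-below-peak : ∀ {x p} → h x Ĥ.≤ Ĥ.peak p → ∃ λ m → x Ĝ.≤ Ĝ.peak m × σ m ≡ p
  back-below-peak le with h-back le
  ... | z , xz , hz = Ĝ.peakAbove z , xz ◅◅ Ĝ.≤-peakAbove z ,
    Ĥ.peak-below-peak (subst (Ĥ._≤ _) hz (h-below-peak refl (Ĝ.≤-peakAbove z)))

  σ-surjective : ∀ p → ∃ λ m → σ m ≡ p
  σ-surjective p with h-surjective (Ĥ.peak p)
  ... | x , hx with back-below-peak (subst (Ĥ._≤ Ĥ.peak p) (sym hx) ε)
  ...   | m , _ , eq = m , eq

  copy-onto-side : ∀ {x w} s → ¬ Ĝ.IsVertex x → h x ≡ vtx w →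
                   ∃₂ λ t e → h (Ĝ.copy t e) ≡ Ĥ.side s w
  copy-onto-side {x} {w} s nv hx
    with h-back (subst (Ĥ._≤ Ĥ.side s w) (sym hx) (Ĥ.vtx≺side s w ◅ ε))
  ... | z , xz , hz with Ĝ.above-nonvertex z nv xz
  ...   | inj₁ refl = ⊥-elim (Ĥ.side≢vtx (trans (sym hz) hx))
  ...   | inj₂ (inj₁ (t , e , refl)) = t , e , hz
  ...   | inj₂ (inj₂ (m , refl)) = ⊥-elim (Ĥ.side≢peak _ (trans (sym hz) (h-peak m)))

  -- If a non-vertex were mapped to a vertex w, the sides of w would lift to edge copies, which
  -- lie below the same peaks; but only one side of w lies below ∞a.
  h-preserves-nonvertex : ∀ {x} → ¬ Ĝ.IsVertex x → ¬ Ĥ.IsVertex (h x)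
  h-preserves-nonvertex nv (w , hx) with copy-onto-side a nv hx | copy-onto-side b nv hx
  ... | t , e , ha | t' , e' , hb
    with back-below-peak (subst (Ĥ._≤ Ĥ.peak (∞ a)) (sym ha) (Ĥ.side≺∞ a w ◅ ε))
  ...   | m , le , σm = Ĥ.side≰opp-∞ {b}
    (subst (Ĥ._≤ Ĥ.peak (∞ a)) hb (h-below-peak σm (Ĝ.copy-below-top (Ĝ.copy-peaks-are-tops le))))

  vertex-preimage : ∀ x {w} → h x ≡ vtx w → Ĝ.IsVertex x
  vertex-preimage x hx with Ĝ.vertex? x
  ... | yes isv = isv
  ... | no nv = ⊥-elim (h-preserves-nonvertex nv (_ , hx))

  vertex-hit : ∀ w → ∃ λ v → h (vtx v) ≡ vtx w
  vertex-hit w with h-surjective (vtx w)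
  ... | x , hx with vertex-preimage x hx
  ...   | v , refl = v , hx

  -- The hypothesis that H has a vertex is used only here, to obtain a vertex of G.
  v₀ : V G
  v₀ = proj₁ (vertex-hit w₀)

  side-image-below : Ĝ.IsolatedOrAdjacent v₀ → ∀ m → ∃ λ s → h (Ĝ.side s v₀) Ĥ.≤ Ĥ.peak (σ m)
  side-image-below ia (∞ s) = s , h-below-peak refl (Ĝ.side≺∞ s v₀ ◅ ε)
  side-image-below ia ⊤₁ = a , h-below-peak refl (Ĝ.side-below-top a ia ⊤₁-not-inf)
  side-image-below ia ⊤₂ = a , h-below-peak refl (Ĝ.side-below-top a ia ⊤₂-not-inf)

  -- If a top went to ∞ t, the images of both sides of v₀ would lie below ∞ t, and the peak going
  -- to the other ∞ would put the image of one of them below both ∞'s, making it a vertex.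
  σ-preserves-non-inf : ∀ {m} → ¬ IsInf m → ¬ IsInf (σ m)
  σ-preserves-non-inf {m} fin (t , σm) = Ĝ.isolated-or-adjacent v₀ λ ia →
    let (m' , σm') = σ-surjective (∞ (opp t))
        (s , le') = side-image-below ia m'
        le = h-below-peak σm (Ĝ.side-below-top s ia fin)
    in h-preserves-nonvertex (Ĝ.side-nonvertex s v₀)
         (Ĥ.below-both-∞⇒vertex t le (subst (λ p → h (Ĝ.side s v₀) Ĥ.≤ Ĥ.peak p) σm' le'))

  ∞-preimage : ∀ t → ∃ λ s → σ (∞ s) ≡ ∞ t
  ∞-preimage t with σ-surjective (∞ t)
  ... | ∞ s , eq = s , eq
  ... | ⊤₁ , eq = ⊥-elim (σ-preserves-non-inf ⊤₁-not-inf (t , eq))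
  ... | ⊤₂ , eq = ⊥-elim (σ-preserves-non-inf ⊤₂-not-inf (t , eq))

  τ : Side → Side
  τ t = proj₁ (∞-preimage t)

  τ-injective : τ a ≢ τ b
  τ-injective eq with trans (sym (proj₂ (∞-preimage a)))
                             (trans (cong (λ s → σ (∞ s)) eq) (proj₂ (∞-preimage b)))
  ... | ()

  τ-opp : ∀ s → τ (opp s) ≡ opp (τ s)
  τ-opp = side-injective-opp τ τ-injective

  σ-∞ : ∀ s → σ (∞ s) ≡ ∞ (τ s)
  σ-∞ s = subst (λ s' → σ (∞ s') ≡ ∞ (τ s)) (side-injective-involutive τ τ-injective s)
                (proj₂ (∞-preimage (τ s)))

  -- σ maps the ∞'s to ∞'s, so ⊤₁ and ⊤₂ must both be hit by tops.
  σ-tops-distinct : σ ⊤₁ ≢ σ ⊤₂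
  σ-tops-distinct eq with σ-surjective ⊤₁ | σ-surjective ⊤₂
  ... | m₁ , σm₁ | m₂ , σm₂ = ⊤₁≢⊤₂ (begin
    ⊤₁     ≡⟨ sym σm₁ ⟩
    σ m₁   ≡⟨ collapse m₁ σm₁ ⊤₁-not-inf ⟩
    σ ⊤₁   ≡⟨ sym (collapse m₂ σm₂ ⊤₂-not-inf) ⟩
    σ m₂   ≡⟨ σm₂ ⟩
    ⊤₂     ∎)
    where
    open ≡-Reasoning
    ⊤₁≢⊤₂ : ⊤₁ ≢ ⊤₂
    ⊤₁≢⊤₂ ()
    collapse : ∀ m {p} → σ m ≡ p → ¬ IsInf p → σ m ≡ σ ⊤₁
    collapse (∞ s) σm fin = ⊥-elim (fin (τ s , trans (sym σm) (σ-∞ s)))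
    collapse ⊤₁ _ _ = refl
    collapse ⊤₂ _ _ = sym eq

  h-vertex : ∀ v → Ĥ.IsVertex (h (vtx v))
  h-vertex v = Ĥ.below-both-∞⇒vertex (τ a) (below-∞ a refl) (below-∞ b (cong ∞ (τ-opp a)))
    where
    below-∞ : ∀ s {t} → ∞ (τ s) ≡ t → h (vtx v) Ĥ.≤ Ĥ.peak t
    below-∞ s eq = h-below-peak (trans (σ-∞ s) eq) (Ĝ.vtx≺side s v ◅ Ĝ.side≺∞ s v ◅ ε)

  g : V G → V H
  g v = proj₁ (h-vertex v)

  h-vtx : ∀ v → h (vtx v) ≡ vtx (g v)
  h-vtx v = proj₂ (h-vertex v)

  g-surjective : Surjective g
  g-surjective w =
    let (v , hv) = vertex-hit w in v , Ĥ.vtx-injective (trans (sym (h-vtx v)) hv)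

  h-side-not-∞ : ∀ s v → h (Ĝ.side s v) ≢ Ĥ.peak (∞ (τ s))
  h-side-not-∞ s v eq = Ĝ.isolated-or-adjacent v λ ia →
    σ-preserves-non-inf ⊤₁-not-inf
      (τ s , Ĥ.peak-below-peak
               (subst (Ĥ._≤ _) eq (h-below-peak refl (Ĝ.side-below-top s ia ⊤₁-not-inf))))

  h-side : ∀ s v → h (Ĝ.side s v) ≡ Ĥ.side (τ s) (g v)
  h-side s v = Ĥ.side-between (τ s)
    (subst (Ĥ._≤ h (Ĝ.side s v)) (h-vtx v) (h-mono (Ĝ.vtx≺side s v ◅ ε)))
    (h-below-peak (σ-∞ s) (Ĝ.side≺∞ s v ◅ ε))
    (h-preserves-nonvertex (Ĝ.side-nonvertex s v))
    (h-side-not-∞ s v)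

  h-above-side : ∀ s v {y} → Ĝ.side s v Ĝ.≤ y → Ĥ.side (τ s) (g v) Ĥ.≤ h y
  h-above-side s v le = subst (Ĥ._≤ _) (h-side s v) (h-mono le)

  h-copy : ∀ t e → Ĥ.IsCopy (h (Ĝ.copy t e))
  h-copy t e = Ĥ.below-two-peaks⇒copy
    (h-below-peak refl (Ĝ.copy-below-top ⊤₁-not-inf))
    (h-below-peak refl (Ĝ.copy-below-top ⊤₂-not-inf))
    σ-tops-distinct
    not-below-∞
    (h-preserves-nonvertex (Ĝ.copy-nonvertex t e))
    where
    not-below-∞ : ∀ s → ¬ h (Ĝ.copy t e) Ĥ.≤ Ĥ.peak (∞ s)
    not-below-∞ s le with back-below-peak le
    ... | m , le' , σm = σ-preserves-non-inf (Ĝ.copy-peaks-are-tops le') (s , σm)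

  g-edge : ∀ e → Adj H (g (src G e)) (g (tgt G e))
  g-edge e = adjacent (h-copy a e)
    where
    adjacent : Ĥ.IsCopy (h (Ĝ.copy a e)) → Adj H (g (src G e)) (g (tgt G e))
    adjacent (t , f , eq) = Ĥ.adjacent-below-copy {s = τ a} src-side tgt-side
      where
      src-side : Ĥ.side (τ a) (g (src G e)) Ĥ.≤ Ĥ.copy t f
      src-side = subst (Ĥ.side (τ a) (g (src G e)) Ĥ.≤_) eq
                       (h-above-side a (src G e) (srca≺e₁ e ◅ ε))
      tgt-side : Ĥ.side (opp (τ a)) (g (tgt G e)) Ĥ.≤ Ĥ.copy t f
      tgt-side = subst₂ (λ s c → Ĥ.side s (g (tgt G e)) Ĥ.≤ c) (τ-opp a) eq
                        (h-above-side b (tgt G e) (tgtb≺e₁ e ◅ ε))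

  copy-preimage : ∀ s u {t' f'} → h (Ĝ.side s u) Ĥ.≤ Ĥ.copy t' f' →
                  ∃₂ λ t e → Ĝ.side s u Ĝ.≤ Ĝ.copy t e × h (Ĝ.copy t e) ≡ Ĥ.copy t' f'
  copy-preimage s u le with h-back le
  ... | z , uz , hz with Ĝ.above-nonvertex z (Ĝ.side-nonvertex s u) uz
  ...   | inj₁ refl = ⊥-elim (Ĥ.side≢copy (trans (sym (h-side s u)) hz))
  ...   | inj₂ (inj₁ (t , e , refl)) = t , e , uz , hz
  ...   | inj₂ (inj₂ (m , refl)) = ⊥-elim (Ĥ.copy≢peak _ (trans (sym hz) (h-peak m)))

  neighbour-below-copy : ∀ u {w t' f'} → Ĥ.side (τ a) (g u) Ĥ.≤ Ĥ.copy t' f' →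
                         Ĥ.side (opp (τ a)) w Ĥ.≤ Ĥ.copy t' f' → ∃ λ v → Adj G u v × g v ≡ w
  neighbour-below-copy u {w} {t'} {f'} u-side w-side =
    neighbour (copy-preimage a u (subst (Ĥ._≤ Ĥ.copy t' f') (sym (h-side a u)) u-side))
    where
    neighbour : (∃₂ λ t e → Ĝ.side a u Ĝ.≤ Ĝ.copy t e × h (Ĝ.copy t e) ≡ Ĥ.copy t' f') →
                ∃ λ v → Adj G u v × g v ≡ w
    neighbour (t , e , le , he) =
      v , adjacent , Ĥ.sides-below-same-copy (t' , f' , refl) v-side w-side
      where
      v : V G
      v = Ĝ.endpoint b t e
      adjacent : Adj G u v
      adjacent = subst (λ x → Adj G x v) (sym (Ĝ.side-below-copy le)) (Ĝ.endpoints-adjacent a t e)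
      v-side : Ĥ.side (opp (τ a)) (g v) Ĥ.≤ Ĥ.copy t' f'
      v-side = subst₂ (λ s c → Ĥ.side s (g v) Ĥ.≤ c) (τ-opp a) he
                      (h-above-side b v (Ĝ.side≺copy b t e ◅ ε))

  g-back : ∀ u w → Adj H (g u) w → ∃ λ v → Adj G u v × g v ≡ w
  g-back u w α = below-copy (Ĥ.over-is-copy (τ a) α)
    where
    below-copy : Ĥ.IsCopy (Ĥ.over (τ a) α) → ∃ λ v → Adj G u v × g v ≡ w
    below-copy (t' , f' , over-α) = neighbour-below-copy u
      (subst (Ĥ.side (τ a) (g u) Ĥ.≤_) over-α (Ĥ.side≺over (τ a) α ◅ ε))
      (subst (Ĥ.side (opp (τ a)) w Ĥ.≤_) over-α (Ĥ.opp-side≺over (τ a) α ◅ ε))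

  g-locally-surjective : LocSurjHom G H g
  g-locally-surjective = record { hom = g-hom ; back = g-back }
    where
    g-hom : ∀ u v → Adj G u v → Adj H (g u) (g v)
    g-hom _ _ (e , inj₁ (refl , refl)) = g-edge e
    g-hom _ _ (e , inj₂ (refl , refl)) = Ĥ.adj-sym (g-edge e)

theorem4 : (G H : Graph) → Graph.V H →
    (Σ (Graph.V G → Graph.V H) λ g → Surjective g × LocSurjHom G H g)
    ⇔ (Σ (PosElt G → PosElt H) λ h → Surjective h × PMorphism (Pos G) (Pos H) h)
theorem4 G H w₀ = mk⇔
  (λ { (g , g-surjective , g-lsh) →
         let open Lift G H g g-surjective g-lsh in lift , lift-surjective , lift-p-morphism })
  (λ { (h , h-surjective , h-pm) →
         let open Reflect G H w₀ h h-surjective h-pm in g , g-surjective , g-locally-surjective })
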